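{- Let $x:[t]\to\mathbb{Z}\setminus\{0\}$ be such that $(x(1),\ldots,x(t))$ is generalized Catalan, let $\pi\in\mathfrak{S}_t$ be the permutation associated to $x$, and let $T\subset[t]$. If the restriction $(x\circ\pi)|_T$ is generalized Catalan, then the restriction $x|_{\pi(T)}$ is generalized Catalan.
   Context: A list $(x_1,\ldots,x_t)$ of nonzero integers is generalized Catalan if $\sum_{i=1}^t x_i=0$ and $\sum_{i=1}^q x_i\ge0$ for all $1\le q\le t$. For $T=\{i_1<\cdots<i_a\}\subset[t]$, a map $w:T\to\mathbb{Z}\setminus\{0\}$ is called generalized Catalan if the list $(w(i_1),\ldots,w(i_a))$ is generalized Catalan. $[t]=\{1,\ldots,t\}$. The permutation $\pi$ associated to $x$: $\pi(1)=1$; for $2\le q\le t$, let $s=\min\{i\in[t]: i\notin\{\pi(1),\ldots,\pi(q-1)\},\ x(i)<0\}$ and $s'=\min\{i\in[t]: i\notin\{\pi(1),\ldots,\pi(q-1)\},\ x(i)>0\}$ (minimum of the empty set is $\infty$); then $\pi(q)=s$ if $s<\infty$ and $\sum_{i=1}^{q-1}x(\pi(i))+x(s)\ge0$, and $\pi(q)=s'$ otherwise. (This construction always yields a permutation of $[t]$.) -}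

module Defs where

open import Data.Nat using (ℕ)
open import Data.Integer using (ℤ; 0ℤ; _≤_; _<_; _+_)
open import Data.Fin using (Fin; toℕ)
open import Data.Fin.Subset using (Subset; _∈_)
open import Data.Fin.Subset.Properties using (_∈?_)
open import Data.Fin.Permutation using (Permutation′; _⟨$⟩ʳ_; _⟨$⟩ˡ_)
open import Data.List using (List; map; filter; take; allFin; foldr)
open import Data.List.Relation.Unary.All using (All)
open import Data.Vec using (tabulate; lookup)
open import Data.Bool using (true)
open import Data.Product using (_×_)
open import Relation.Binary.PropositionalEquality using (_≡_; _≢_)
open import Relation.Nullary using (¬_)

sumℤ : List ℤ → ℤ
sumℤ = foldr _+_ 0ℤ

-- A list of integers is generalized Catalan: all entries nonzero,
-- total sum 0, every prefix sum ≥ 0 (q = 0 and q > length are harmless).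
IsGenCatalan : List ℤ → Set
IsGenCatalan l = All (λ y → y ≢ 0ℤ) l × sumℤ l ≡ 0ℤ × (∀ (q : ℕ) → 0ℤ ≤ sumℤ (take q l))

restrict : ∀ {t} → (Fin t → ℤ) → Subset t → List ℤ
restrict {t} w T = map w (filter (λ i → i ∈? T) (allFin t))

image : ∀ {t} → Permutation′ t → Subset t → Subset t
image π T = tabulate (λ j → lookup T (π ⟨$⟩ˡ j))

module _ {t : ℕ} (x : Fin t → ℤ) (π : Permutation′ t) where

  -- Σ_{i<q} x(π(i))  (0-indexed; paper's Σ_{i=1}^{q-1} for paper index q)
  prefixSum : Fin t → ℤ
  prefixSum q = sumℤ (take (toℕ q) (map (λ r → x (π ⟨$⟩ʳ r)) (allFin t)))

  -- i ∉ {π(0),…,π(q-1)}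
  Unused : Fin t → Fin t → Set
  Unused q i = toℕ q Data.Nat.≤ toℕ (π ⟨$⟩ˡ i)

  MinUnusedNeg : Fin t → Fin t → Set
  MinUnusedNeg q i = Unused q i × x i < 0ℤ ×
    (∀ j → toℕ j Data.Nat.< toℕ i → Unused q j → ¬ (x j < 0ℤ))

  MinUnusedPos : Fin t → Fin t → Set
  MinUnusedPos q i = Unused q i × 0ℤ < x i ×
    (∀ j → toℕ j Data.Nat.< toℕ i → Unused q j → ¬ (0ℤ < x j))

  -- π is the permutation associated to x (0-indexed version of the paper's rule)
  IsAssociatedPerm : Set
  IsAssociatedPerm =
    (∀ (q : Fin t) → toℕ q ≡ 0 → π ⟨$⟩ʳ q ≡ q) ×
    (∀ (q : Fin t) → 1 Data.Nat.≤ toℕ q →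
       (∀ s → MinUnusedNeg q s → 0ℤ ≤ prefixSum q + x s → π ⟨$⟩ʳ q ≡ s) ×
       (∀ s′ → MinUnusedPos q s′ →
          (∀ s → MinUnusedNeg q s → prefixSum q + x s < 0ℤ) → π ⟨$⟩ʳ q ≡ s′))

-- The rule defining π places a negative entry j
-- before every later entry k. Otherwise the step placing k skipped the least unused negative s ≤ j,
-- so the current prefix sum plus x s was negative and k was the least unused positive. That is
-- absurd if k is negative; so negative entries are placed in order, hence placed entries beyond s
-- are positive, while unplaced entries before s precede k and are negative. Thus the prefix sum of
-- x through s is at most the current prefix sum plus x s, i.e. negative: a contradiction.
-- Consequently every prefix x(1),…,x(c) can be matched with the first d steps of π: these steps
-- only place entries below c, and they place every negative entry below c. Restricted to T, the
-- prefix of x|π(T) below c exceeds a prefix sum of (x∘π)|T by positive entries only, so it is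
-- nonnegative; the total sums agree by reindexing along π.

module Submission where

open import Defs
open import Data.Nat as ℕ using (ℕ; zero; suc; z≤n)
import Data.Nat.Properties as ℕP
open import Data.Integer as ℤ using (ℤ; 0ℤ; _+_; _≤_; _<_)
import Data.Integer.Properties as ℤP
open import Data.Fin as F using (Fin; zero; suc; toℕ)
open import Data.Fin.Properties using (any?; toℕ<n; toℕ-injective)
open import Data.Fin.Subset using (Subset; _∈_)
open import Data.Fin.Subset.Properties using (_∈?_)
open import Data.Fin.Permutation using (Permutation′; _⟨$⟩ʳ_; _⟨$⟩ˡ_; inverseˡ; inverseʳ)
open import Data.List using ([]; _∷_; map; filter; take; allFin; tabulate)
import Data.List.Properties as LP
open import Data.List.Relation.Unary.All using (All)
import Data.List.Relation.Unary.All.Properties as AllP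
open import Data.Vec using (lookup)
import Data.Vec.Properties as VP
open import Data.Bool using (true; false; if_then_else_)
open import Data.Product using (∃; _×_; _,_; proj₁; proj₂)
open import Data.Sum using (_⊎_; inj₁; inj₂; [_,_])
open import Function using (_∘_; id; _⇔_; mk⇔; Equivalence)
open import Relation.Nullary using (Dec; yes; no; does; ¬_; contradiction)
open import Relation.Nullary.Decidable using (_×-dec_)
open import Relation.Unary using (Pred; Decidable)
open import Relation.Binary.PropositionalEquality hiding ([_])
open import Relation.Binary.Definitions using (tri<; tri≈; tri>)
open import Algebra.Properties.CommutativeMonoid.Sum ℤP.+-0-commutativeMonoid
  using (sum; sum-cong-≗; sum-permute; ∑-distrib-+; sum-replicate-zero)

when : ∀ {p} {P : Set p} → Dec P → ℤ → ℤ
when P? v = if does P? then v else 0ℤ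

sumBelow : ∀ {n} → ℕ → (Fin n → ℤ) → ℤ
sumBelow c f = sum (λ i → when (toℕ i ℕ.<? c) (f i))

sum-mono-≤ : ∀ {n} {f g : Fin n → ℤ} → (∀ i → f i ≤ g i) → sum f ≤ sum g
sum-mono-≤ {zero} f≤g = ℤP.≤-refl
sum-mono-≤ {suc n} f≤g = ℤP.+-mono-≤ (f≤g zero) (sum-mono-≤ (f≤g ∘ suc))

sum-when-≟ : ∀ {n} (f : Fin n → ℤ) (s : Fin n) → sum (λ j → when (j F.≟ s) (f j)) ≡ f s
sum-when-≟ {suc n} f zero = trans (cong (f zero +_) (sum-replicate-zero n)) (ℤP.+-identityʳ _)
sum-when-≟ {suc n} f (suc s) = trans (ℤP.+-identityˡ _) (sum-when-≟ (f ∘ suc) s)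

sum-reindex : ∀ {n} (π : Permutation′ n) (h : Fin n → Fin n → ℤ) →
              sum (λ j → h (π ⟨$⟩ˡ j) j) ≡ sum (λ r → h r (π ⟨$⟩ʳ r))
sum-reindex π h = trans (sum-permute (λ j → h (π ⟨$⟩ˡ j) j) π)
                        (sum-cong-≗ (λ r → cong (λ i → h i (π ⟨$⟩ʳ r)) (inverseˡ π)))

when-yes : ∀ {p} {P : Set p} (P? : Dec P) {v} → P → when P? v ≡ v
when-yes (yes _) _ = refl
when-yes (no ¬p) p = contradiction p ¬p

when-elim : ∀ {p q} {P : Set p} (Q : ℤ → Set q) (P? : Dec P) {v} →
  (P → Q v) → (¬ P → Q 0ℤ) → Q (when P? v)
when-elim Q (yes p) onYes _ = onYes p
when-elim Q (no ¬p) _ onNo = onNo ¬p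

when-resp-⇔ : ∀ {p q} {P : Set p} {Q : Set q} (P? : Dec P) (Q? : Dec Q) → P ⇔ Q →
              ∀ v → when P? v ≡ when Q? v
when-resp-⇔ (yes _) (yes _) _ _ = refl
when-resp-⇔ (no _) (no _) _ _ = refl
when-resp-⇔ (yes p) (no ¬q) P⇔Q _ = contradiction (Equivalence.to P⇔Q p) ¬q
when-resp-⇔ (no ¬p) (yes q) P⇔Q _ = contradiction (Equivalence.from P⇔Q q) ¬p

sumℤ-tabulate : ∀ {n} (f : Fin n → ℤ) → sumℤ (tabulate f) ≡ sum f
sumℤ-tabulate {zero} f = refl
sumℤ-tabulate {suc n} f = cong (f zero +_) (sumℤ-tabulate (f ∘ suc))

sumℤ-take-tabulate : ∀ {n} (f : Fin n → ℤ) c → sumℤ (take c (tabulate f)) ≡ sumBelow c f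
sumℤ-take-tabulate {zero} f zero = refl
sumℤ-take-tabulate {zero} f (suc c) = refl
sumℤ-take-tabulate {suc n} f zero = sym (trans (ℤP.+-identityˡ _) (sum-replicate-zero n))
sumℤ-take-tabulate {suc n} f (suc c) = cong (f zero +_) (sumℤ-take-tabulate (f ∘ suc) c)

sumℤ-map-allFin : ∀ {n} (f : Fin n → ℤ) → sumℤ (map f (allFin n)) ≡ sum f
sumℤ-map-allFin f = trans (cong sumℤ (LP.map-tabulate id f)) (sumℤ-tabulate f)

sumℤ-take-map-allFin : ∀ {n} (f : Fin n → ℤ) c → sumℤ (take c (map f (allFin n))) ≡ sumBelow c f
sumℤ-take-map-allFin f c = trans (cong (sumℤ ∘ take c) (LP.map-tabulate id f)) (sumℤ-take-tabulate f c)

module _ {a p} {A : Set a} {P : Pred A p} (P? : Decidable P) where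

  sumℤ-map-filter : ∀ (w : A → ℤ) l → sumℤ (map w (filter P? l)) ≡ sumℤ (map (λ i → when (P? i) (w i)) l)
  sumℤ-map-filter w [] = refl
  sumℤ-map-filter w (i ∷ l) with does (P? i)
  ... | true = cong (w i +_) (sumℤ-map-filter w l)
  ... | false = trans (sumℤ-map-filter w l) (sym (ℤP.+-identityˡ _))

  take-filter : ∀ q l → ∃ λ c → take q (filter P? l) ≡ filter P? (take c l)
  take-filter zero l = 0 , refl
  take-filter (suc q) [] = 0 , refl
  take-filter (suc q) (i ∷ l) with P? i
  ... | yes Pi = let c , e = take-filter q l in suc c , trans (cong (i ∷_) e) (sym (LP.filter-accept P? Pi))
  ... | no ¬Pi = let c , e = take-filter (suc q) l in suc c , trans e (sym (LP.filter-reject P? ¬Pi))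

  filter-take : ∀ c l → ∃ λ q → filter P? (take c l) ≡ take q (filter P? l)
  filter-take zero l = 0 , refl
  filter-take (suc c) [] = 0 , refl
  filter-take (suc c) (i ∷ l) with does (P? i)
  ... | true = let q , e = filter-take c l in suc q , cong (i ∷_) e
  ... | false = filter-take c l

sumℤ-map-filter-take-allFin : ∀ {n p} {P : Pred (Fin n) p} (P? : Decidable P) (w : Fin n → ℤ) c →
  sumℤ (map w (filter P? (take c (allFin n)))) ≡ sumBelow c (λ i → when (P? i) (w i))
sumℤ-map-filter-take-allFin {n} P? w c = begin
  sumℤ (map w (filter P? (take c (allFin n))))      ≡⟨ sumℤ-map-filter P? w (take c (allFin n)) ⟩
  sumℤ (map (λ i → when (P? i) (w i)) (take c (allFin n))) ≡⟨ cong sumℤ (LP.take-map c (allFin n)) ⟨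
  sumℤ (take c (map (λ i → when (P? i) (w i)) (allFin n))) ≡⟨ sumℤ-take-map-allFin _ c ⟩
  sumBelow c (λ i → when (P? i) (w i))                ∎
  where open ≡-Reasoning

module _ {n} (w : Fin n → ℤ) (S : Subset n) where

  sumℤ-restrict : sumℤ (restrict w S) ≡ sum (λ i → when (i ∈? S) (w i))
  sumℤ-restrict = trans (sumℤ-map-filter (_∈? S) w (allFin n)) (sumℤ-map-allFin (λ i → when (i ∈? S) (w i)))

  sumℤ-take-restrict : ∀ q → ∃ λ c → sumℤ (take q (restrict w S)) ≡ sumBelow c (λ i → when (i ∈? S) (w i))
  sumℤ-take-restrict q =
    let c , e = take-filter (_∈? S) q (allFin n) in
    c , trans (cong sumℤ (LP.take-map q _))
              (trans (cong (sumℤ ∘ map w) e) (sumℤ-map-filter-take-allFin (_∈? S) w c))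

  sumBelow-restrict : ∀ c → ∃ λ q → sumBelow c (λ i → when (i ∈? S) (w i)) ≡ sumℤ (take q (restrict w S))
  sumBelow-restrict c =
    let q , e = filter-take (_∈? S) c (allFin n) in
    q , trans (sym (sumℤ-map-filter-take-allFin (_∈? S) w c))
              (trans (cong (sumℤ ∘ map w) e) (sym (cong sumℤ (LP.take-map q _))))

∈-image⇔ : ∀ {n} (π : Permutation′ n) (T : Subset n) j → j ∈ image π T ⇔ π ⟨$⟩ˡ j ∈ T
∈-image⇔ π T j = mk⇔
  (λ j∈ → VP.lookup⇒[]= _ T (trans (sym (VP.lookup∘tabulate f j)) (VP.[]=⇒lookup j∈)))
  (λ πj∈ → VP.lookup⇒[]= j _ (trans (VP.lookup∘tabulate f j) (VP.[]=⇒lookup πj∈)))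
  where f = λ k → lookup T (π ⟨$⟩ˡ k)

when-∈-image : ∀ {n} (π : Permutation′ n) (T : Subset n) j v →
  when (j ∈? image π T) v ≡ when (π ⟨$⟩ˡ j ∈? T) v
when-∈-image π T j = when-resp-⇔ (j ∈? image π T) (π ⟨$⟩ˡ j ∈? T) (∈-image⇔ π T j)

sumℤ-restrict-image : ∀ {n} (w : Fin n → ℤ) (π : Permutation′ n) (T : Subset n) →
  sumℤ (restrict w (image π T)) ≡ sumℤ (restrict (λ r → w (π ⟨$⟩ʳ r)) T)
sumℤ-restrict-image w π T = begin
  sumℤ (restrict w (image π T))                    ≡⟨ sumℤ-restrict w (image π T) ⟩
  sum (λ j → when (j ∈? image π T) (w j))          ≡⟨ sum-cong-≗ (λ j → when-∈-image π T j (w j)) ⟩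
  sum (λ j → when (π ⟨$⟩ˡ j ∈? T) (w j))           ≡⟨ sum-reindex π (λ r j → when (r ∈? T) (w j)) ⟩
  sum (λ r → when (r ∈? T) (w (π ⟨$⟩ʳ r)))         ≡⟨ sumℤ-restrict (λ r → w (π ⟨$⟩ʳ r)) T ⟨
  sumℤ (restrict (λ r → w (π ⟨$⟩ʳ r)) T)           ∎
  where open ≡-Reasoning

least-witness : ∀ {n p} {P : Pred (Fin n) p} → Decidable P → ∀ {i} → P i →
  ∃ λ m → P m × toℕ m ℕ.≤ toℕ i × (∀ j → toℕ j ℕ.< toℕ m → ¬ P j)
least-witness {suc n} P? {i} Pi with P? zero
... | yes P0 = zero , P0 , z≤n , λ _ ()
least-witness {suc n} P? {zero} Pi | no ¬P0 = contradiction Pi ¬P0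
least-witness {suc n} P? {suc i} Pi | no ¬P0 =
  let m , Pm , m≤i , least = least-witness (P? ∘ suc) Pi in
  suc m , Pm , ℕ.s≤s m≤i , λ { zero _ → ¬P0 ; (suc j) (ℕ.s≤s j<m) → least j j<m }

module AssociatedPermutation {t} {x : Fin t → ℤ} {π : Permutation′ t}
  (x≢0 : ∀ i → x i ≢ 0ℤ) (sum≡0 : sum x ≡ 0ℤ) (sumBelow≥0 : ∀ c → 0ℤ ≤ sumBelow c x)
  (associated : IsAssociatedPerm x π) where

  position : Fin t → ℕ
  position j = toℕ (π ⟨$⟩ˡ j)

  sign : ∀ j → x j < 0ℤ ⊎ 0ℤ < x j
  sign j with ℤP.<-cmp (x j) 0ℤ
  ... | tri< neg _ _ = inj₁ neg
  ... | tri≈ _ x≡0 _ = contradiction x≡0 (x≢0 j)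
  ... | tri> _ _ pos = inj₂ pos

  prefixSum≡ : ∀ q → prefixSum x π q ≡ sum (λ j → when (position j ℕ.<? toℕ q) (x j))
  prefixSum≡ q = trans (sumℤ-take-map-allFin (λ r → x (π ⟨$⟩ʳ r)) (toℕ q))
                       (sym (sum-reindex π (λ r j → when (toℕ r ℕ.<? toℕ q) (x j))))

  least-unused-negative : ∀ {q j} → Unused x π q j → x j < 0ℤ →
    ∃ λ s → MinUnusedNeg x π q s × toℕ s ℕ.≤ toℕ j
  least-unused-negative {q} u neg =
    let s , (us , negs) , s≤j , least =
          least-witness (λ k → (toℕ q ℕ.≤? position k) ×-dec (x k ℤ.<? 0ℤ)) (u , neg)
    in s , (us , negs , λ k k<s uk negk → least k k<s (uk , negk)) , s≤j

  least-unused-positive : ∀ {q j} → Unused x π q j → 0ℤ < x j → ∃ (MinUnusedPos x π q)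
  least-unused-positive {q} u pos =
    let s , (us , poss) , _ , least =
          least-witness (λ k → (toℕ q ℕ.≤? position k) ×-dec (0ℤ ℤ.<? x k)) (u , pos)
    in s , us , poss , λ k k<s uk posk → least k k<s (uk , posk)

  MinUnusedNeg-unique : ∀ {q s s′} → MinUnusedNeg x π q s → MinUnusedNeg x π q s′ → s ≡ s′
  MinUnusedNeg-unique {s = s} {s′} (us , negs , least) (us′ , negs′ , least′)
    with ℕP.<-cmp (toℕ s) (toℕ s′)
  ... | tri< s<s′ _ _ = contradiction negs (least′ s s<s′ us)
  ... | tri≈ _ s≡s′ _ = toℕ-injective s≡s′
  ... | tri> _ _ s′<s = contradiction negs′ (least s′ s′<s us′)

  sum-≤-prefixSum+ : ∀ {q s} (G : Fin t → ℤ) → Unused x π q s →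
    (∀ j → position j ℕ.< toℕ q → G j ≤ x j) → G s ≤ x s →
    (∀ j → toℕ q ℕ.≤ position j → j ≢ s → G j ≤ 0ℤ) →
    sum G ≤ prefixSum x π q + x s
  sum-≤-prefixSum+ {q} {s} G us used at-s unused = begin
    sum G                                               ≤⟨ sum-mono-≤ bound ⟩
    sum (λ j → usedPart j + when (j F.≟ s) (x j))       ≡⟨ ∑-distrib-+ usedPart (λ j → when (j F.≟ s) (x j)) ⟩
    sum usedPart + sum (λ j → when (j F.≟ s) (x j))     ≡⟨ cong₂ _+_ (sym (prefixSum≡ q)) (sum-when-≟ x s) ⟩
    prefixSum x π q + x s                               ∎
    where
    open ℤP.≤-Reasoning
    usedPart : Fin t → ℤ
    usedPart j = when (position j ℕ.<? toℕ q) (x j)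
    bound : ∀ j → G j ≤ usedPart j + when (j F.≟ s) (x j)
    bound j with j F.≟ s
    ... | yes refl = when-elim (λ u → G j ≤ u + x j) (position j ℕ.<? toℕ q)
      (λ s-used → contradiction us (ℕP.<⇒≱ s-used))
      (λ _ → subst (G j ≤_) (sym (ℤP.+-identityˡ _)) at-s)
    ... | no j≢s = when-elim (λ u → G j ≤ u + 0ℤ) (position j ℕ.<? toℕ q)
      (λ j-used → subst (G j ≤_) (sym (ℤP.+-identityʳ _)) (used j j-used))
      (λ j-unused → unused j (ℕP.≮⇒≥ j-unused) j≢s)

  unused-positive-exists : ∀ {q s} → MinUnusedNeg x π q s → prefixSum x π q + x s < 0ℤ →
    ∃ (MinUnusedPos x π q)
  unused-positive-exists {q} {s} (us , _ , _) fail
    with any? (λ j → (toℕ q ℕ.≤? position j) ×-dec (0ℤ ℤ.<? x j))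
  ... | yes (j , uj , posj) = least-unused-positive uj posj
  ... | no none = contradiction fail (ℤP.≤⇒≯ (subst (_≤ prefixSum x π q + x s) sum≡0
        (sum-≤-prefixSum+ x us (λ _ _ → ℤP.≤-refl) ℤP.≤-refl nonpositive)))
    where
    nonpositive : ∀ j → toℕ q ℕ.≤ position j → j ≢ s → x j ≤ 0ℤ
    nonpositive j uj _ = [ ℤP.<⇒≤ , (λ posj → contradiction (j , uj , posj) none) ] (sign j)

  1≤position : ∀ {k} → 0 ℕ.< toℕ k → 1 ℕ.≤ position k
  1≤position {k} 0<k = ℕP.n≢0⇒n>0 λ pk≡0 → ℕP.<⇒≢ 0<k (sym (trans (cong toℕ (k≡πˡk pk≡0)) pk≡0))
    where
    k≡πˡk : position k ≡ 0 → k ≡ π ⟨$⟩ˡ k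
    k≡πˡk pk≡0 = trans (sym (inverseʳ π)) (proj₁ associated (π ⟨$⟩ˡ k) pk≡0)

  module _ {k} (1≤pk : 1 ℕ.≤ position k) where

    private
      q = π ⟨$⟩ˡ k

    take-negative : ∀ {s} → MinUnusedNeg x π q s → 0ℤ ≤ prefixSum x π q + x s → k ≡ s
    take-negative mins ok = trans (sym (inverseʳ π)) (proj₁ (proj₂ associated q 1≤pk) _ mins ok)

    take-positive : ∀ {s s′} → MinUnusedNeg x π q s → prefixSum x π q + x s < 0ℤ →
      MinUnusedPos x π q s′ → k ≡ s′
    take-positive mins fail mins′ = trans (sym (inverseʳ π))
      (proj₂ (proj₂ associated q 1≤pk) _ mins′ λ s″ mins″ →
        subst (λ r → prefixSum x π q + x r < 0ℤ) (MinUnusedNeg-unique mins mins″) fail)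

    associated-step : ∀ {s} → MinUnusedNeg x π q s →
      k ≡ s ⊎ (prefixSum x π q + x s < 0ℤ × MinUnusedPos x π q k)
    associated-step {s} mins with 0ℤ ℤ.≤? prefixSum x π q + x s
    ... | yes ok = inj₁ (take-negative mins ok)
    ... | no ¬ok =
      let fail = ℤP.≰⇒> ¬ok
          s′ , mins′ = unused-positive-exists mins fail
      in inj₂ (fail , subst (MinUnusedPos x π q) (sym (take-positive mins fail mins′)) mins′)

  overtaken : ∀ {j k} → x j < 0ℤ → toℕ j ℕ.< toℕ k → position k ℕ.≤ position j →
    ∃ λ s → MinUnusedNeg x π (π ⟨$⟩ˡ k) s × toℕ s ℕ.≤ toℕ j ×
            prefixSum x π (π ⟨$⟩ˡ k) + x s < 0ℤ × MinUnusedPos x π (π ⟨$⟩ˡ k) k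
  overtaken negj j<k pk≤pj with least-unused-negative pk≤pj negj
  ... | s , mins , s≤j with associated-step (1≤position (ℕP.≤-<-trans z≤n j<k)) mins
  ...   | inj₁ refl = contradiction s≤j (ℕP.<⇒≱ j<k)
  ...   | inj₂ (fail , mink) = s , mins , s≤j , fail , mink

  negatives-in-order : ∀ {j k} → x j < 0ℤ → x k < 0ℤ → toℕ j ℕ.< toℕ k → position j ℕ.< position k
  negatives-in-order negj negk j<k = ℕP.≰⇒> λ pk≤pj →
    let _ , _ , _ , _ , _ , posk , _ = overtaken negj j<k pk≤pj in ℤP.<-asym negk posk

  sumBelow-≤-prefixSum+ : ∀ {q s p} → MinUnusedNeg x π q s → MinUnusedPos x π q p → toℕ s ℕ.< toℕ p →
    sumBelow (suc (toℕ s)) x ≤ prefixSum x π q + x s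
  sumBelow-≤-prefixSum+ {q} {s} (us , negs , _) (_ , _ , leastp) s<p =
    sum-≤-prefixSum+ G us used (ℤP.≤-reflexive (when-yes (toℕ s ℕ.<? suc (toℕ s)) (ℕP.n<1+n _))) unused
    where
    G : Fin t → ℤ
    G j = when (toℕ j ℕ.<? suc (toℕ s)) (x j)
    used : ∀ j → position j ℕ.< toℕ q → G j ≤ x j
    used j j-used = when-elim (_≤ x j) (toℕ j ℕ.<? suc (toℕ s)) (λ _ → ℤP.≤-refl) λ j≮1+s →
      let s<j = ℕP.≰⇒> (j≮1+s ∘ ℕ.s≤s) in
      [ (λ negj → contradiction (ℕP.<-trans (negatives-in-order negs negj s<j) j-used) (ℕP.≤⇒≯ us))
      , ℤP.<⇒≤ ] (sign j)
    unused : ∀ j → toℕ q ℕ.≤ position j → j ≢ s → G j ≤ 0ℤ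
    unused j j-unused j≢s = when-elim (_≤ 0ℤ) (toℕ j ℕ.<? suc (toℕ s)) (λ j<1+s →
      let j<p = ℕP.<-trans (ℕP.≤∧≢⇒< (ℕ.s≤s⁻¹ j<1+s) (j≢s ∘ toℕ-injective)) s<p in
      [ ℤP.<⇒≤ , (λ posj → contradiction posj (leastp j j<p j-unused)) ] (sign j))
      λ _ → ℤP.≤-refl

  negative-placed-before-later : ∀ {j k} → x j < 0ℤ → toℕ j ℕ.< toℕ k → position j ℕ.< position k
  negative-placed-before-later negj j<k = ℕP.≰⇒> λ pk≤pj →
    let s , mins , s≤j , fail , mink = overtaken negj j<k pk≤pj
        bound = sumBelow-≤-prefixSum+ mins mink (ℕP.≤-<-trans s≤j j<k)
    in ℤP.≤⇒≯ (ℤP.≤-trans (sumBelow≥0 (suc (toℕ s))) bound) fail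

  -- d is the first step placing an entry ≥ c, or t if there is none.
  prefix-cut : ∀ c → ∃ λ d → (∀ j → position j ℕ.< d → toℕ j ℕ.< c) ×
                               (∀ j → x j < 0ℤ → toℕ j ℕ.< c → position j ℕ.< d)
  prefix-cut c with any? (λ r → c ℕ.≤? toℕ (π ⟨$⟩ʳ r))
  ... | no none =
    t , (λ j _ → ℕP.≰⇒> λ c≤j → none (π ⟨$⟩ˡ j , subst (λ i → c ℕ.≤ toℕ i) (sym (inverseʳ π)) c≤j))
      , (λ j _ _ → toℕ<n (π ⟨$⟩ˡ j))
  ... | yes (_ , late) =
    let m , late-m , _ , earliest = least-witness (λ r → c ℕ.≤? toℕ (π ⟨$⟩ʳ r)) late in
    toℕ m
      , (λ j pj<m → ℕP.≰⇒> λ c≤j →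
           earliest (π ⟨$⟩ˡ j) pj<m (subst (λ i → c ℕ.≤ toℕ i) (sym (inverseʳ π)) c≤j))
      , (λ j negj j<c → subst (position j ℕ.<_) (cong toℕ (inverseˡ π))
           (negative-placed-before-later negj (ℕP.<-≤-trans j<c late-m)))

  prefix-cut-≤ : ∀ {c d} → (∀ j → position j ℕ.< d → toℕ j ℕ.< c) →
    (∀ j → x j < 0ℤ → toℕ j ℕ.< c → position j ℕ.< d) →
    ∀ {p} {P : Fin t → Set p} (P? : Decidable P) j →
    when (position j ℕ.<? d) (when (P? j) (x j)) ≤ when (toℕ j ℕ.<? c) (when (P? j) (x j))
  prefix-cut-≤ {c} {d} early late P? j =
    when-elim (_≤ when (toℕ j ℕ.<? c) (when (P? j) (x j))) (position j ℕ.<? d)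
      (λ pj<d → ℤP.≤-reflexive (sym (when-yes (toℕ j ℕ.<? c) (early j pj<d))))
      (λ pj≮d → when-elim (0ℤ ≤_) (toℕ j ℕ.<? c)
        (λ j<c → when-elim (0ℤ ≤_) (P? j) (λ _ → 0≤xj pj≮d j<c) (λ _ → ℤP.≤-refl))
        (λ _ → ℤP.≤-refl))
    where
    0≤xj : ¬ position j ℕ.< d → toℕ j ℕ.< c → 0ℤ ≤ x j
    0≤xj pj≮d j<c = [ (λ negj → contradiction (late j negj j<c) pj≮d) , ℤP.<⇒≤ ] (sign j)

  restrict-image-prefix≥0 : ∀ T → (∀ q → 0ℤ ≤ sumℤ (take q (restrict (λ r → x (π ⟨$⟩ʳ r)) T))) →
    ∀ q → 0ℤ ≤ sumℤ (take q (restrict x (image π T)))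
  restrict-image-prefix≥0 T y-prefix≥0 q =
    let c , x-prefix = sumℤ-take-restrict x (image π T) q
        d , early , late = prefix-cut c
        q′ , y-prefix = sumBelow-restrict (λ r → x (π ⟨$⟩ʳ r)) T d
    in begin
    0ℤ
      ≤⟨ y-prefix≥0 q′ ⟩
    sumℤ (take q′ (restrict (λ r → x (π ⟨$⟩ʳ r)) T))
      ≡⟨ y-prefix ⟨
    sumBelow d (λ r → when (r ∈? T) (x (π ⟨$⟩ʳ r)))
      ≡⟨ sum-reindex π (λ r j → when (toℕ r ℕ.<? d) (when (r ∈? T) (x j))) ⟨
    sum (λ j → when (position j ℕ.<? d) (when (π ⟨$⟩ˡ j ∈? T) (x j)))
      ≤⟨ sum-mono-≤ (prefix-cut-≤ early late (λ j → π ⟨$⟩ˡ j ∈? T)) ⟩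
    sum (λ j → when (toℕ j ℕ.<? c) (when (π ⟨$⟩ˡ j ∈? T) (x j)))
      ≡⟨ sum-cong-≗ (λ j → cong (when (toℕ j ℕ.<? c)) (when-∈-image π T j (x j))) ⟨
    sumBelow c (λ j → when (j ∈? image π T) (x j))
      ≡⟨ x-prefix ⟨
    sumℤ (take q (restrict x (image π T)))
      ∎
    where open ℤP.≤-Reasoning

proposition2p5 : (t : ℕ) (x : Fin t → ℤ) (π : Permutation′ t) (T : Subset t) →
    IsGenCatalan (map x (allFin t)) →
    IsAssociatedPerm x π →
    IsGenCatalan (restrict (λ i → x (π ⟨$⟩ʳ i)) T) →
    IsGenCatalan (restrict x (image π T))
proposition2p5 t x π T (x≢0s , sumx≡0 , x-prefix≥0) associated (_ , sumy≡0 , y-prefix≥0) =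
    AllP.map⁺ (AllP.filter⁺ (_∈? image π T) (AllP.map⁻ x≢0s))
  , trans (sumℤ-restrict-image x π T) sumy≡0
  , restrict-image-prefix≥0 T y-prefix≥0
  where
  x≢0 : ∀ i → x i ≢ 0ℤ
  x≢0 = AllP.tabulate⁻ {f = x} (subst (All (_≢ 0ℤ)) (LP.map-tabulate id x) x≢0s)
  open AssociatedPermutation {π = π} x≢0 (trans (sym (sumℤ-map-allFin x)) sumx≡0)
    (λ c → subst (0ℤ ≤_) (sumℤ-take-map-allFin x c) (x-prefix≥0 c)) associated
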